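{- For every monomial $u$ of $\mathcal H_K$: (1) $B_+P(u)=\mathfrak P B_+(u)$; (2) $B_+N(u)=\mathfrak N B_+(u)-B_+(\bullet u)$.
   Context: A rooted tree is a finite partially ordered set (elements called vertices) with a unique greatest element, the root, such that for every vertex $v$ the set of vertices greater than $v$ is a chain; if $v$ covers $w$, $w$ is a child of $v$. We regard it as a directed graph with edges from each vertex to its children; a vertex is terminal if it has no children. Rooted trees are considered up to isomorphism; $|t|$ is the number of vertices, $\bullet$ the one-vertex tree. Write $t\lhd t'$ if $t$ is obtained from $t'$ by deleting one terminal non-root vertex and the edge into it. For $t\lhd t'$, $n(t;t')$ is the number of vertices of $t$ at which attaching a new edge to a new terminal vertex yields $t'$, and $m(t;t')$ is the number of edges of $t'$ whose removal (with their terminal endpoint) leaves $t$. Let $k$ be a field of characteristic $0$, $k\{\mathcal T\}$ the vector space with basis the rooted trees, with linear operators $\mathfrak N(t)=\sum_{t\lhd t'}n(t;t')t'$ and $\mathfrak P(t)=\sum_{t'\lhd t}m(t';t)t'$ for $t\ne\bullet$, $\mathfrak P(\bullet)=0$. $\mathcal H_K$ is the polynomial (commutative) algebra over $k$ generated by the rooted trees; its monomials ("forests") are products $t_1\cdots t_n$ of rooted trees, including $1$. $B_+:\mathcal H_K\to k\{\mathcal T\}$ is the linear map sending a monomial $t_1\cdots t_n$ to the rooted tree obtained by adding a new root vertex joined by new edges to the roots of $t_1,\dots,t_n$, with $B_+(1)=\bullet$. $N$ is the derivation of $\mathcal H_K$ with $N(t)=\mathfrak N(t)$ for rooted trees $t$;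 $P$ is the derivation of $\mathcal H_K$ with $P(t)=\mathfrak P(t)$ for rooted trees $t$ with $|t|\ge2$ and $P(\bullet)=1$. -}

module Defs where

open import Level using (Level; _⊔_)
open import Data.Bool using (Bool; true; false; if_then_else_; _∧_)
open import Data.List using (List; []; _∷_; _++_; map; foldr; concatMap)
open import Data.Product using (_×_; _,_; ∃)
open import Data.Nat using (ℕ; zero; suc)
open import Data.Empty using (⊥)
open import Relation.Nullary using (¬_)
open import Relation.Binary.PropositionalEquality using (_≡_)
open import Algebra.Bundles using (CommutativeRing)

-- A representative is a planar tree (a root together with
-- the list of its children subtrees); rooted trees in the paper are the
-- isomorphism classes of these, i.e. the order of children is irrelevant.

data Tree : Set where
  node : List Tree → Tree

• : Tree
• = node []

-- forests (monomials of H_K) are represented by lists of trees;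
-- [] is the monomial 1.
Forest : Set
Forest = List Tree

-- Isomorphism of rooted trees, via a canonical form (children sorted
-- recursively with respect to a structural total order).

mutual
  eqT : Tree → Tree → Bool
  eqT (node xs) (node ys) = eqL xs ys

  eqL : List Tree → List Tree → Bool
  eqL [] [] = true
  eqL [] (_ ∷ _) = false
  eqL (_ ∷ _) [] = false
  eqL (x ∷ xs) (y ∷ ys) = eqT x y ∧ eqL xs ys

mutual
  leT : Tree → Tree → Bool
  leT (node xs) (node ys) = leL xs ys

  leL : List Tree → List Tree → Bool
  leL [] _ = true
  leL (_ ∷ _) [] = false
  leL (x ∷ xs) (y ∷ ys) = if eqT x y then leL xs ys else leT x y

insertT : Tree → List Tree → List Tree
insertT x [] = x ∷ []
insertT x (y ∷ ys) = if leT x y then x ∷ y ∷ ys else y ∷ insertT x ys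

sortT : List Tree → List Tree
sortT = foldr insertT []

mutual
  canon : Tree → Tree
  canon (node ts) = node (sortT (canonL ts))

  canonL : List Tree → List Tree
  canonL [] = []
  canonL (t ∷ ts) = canon t ∷ canonL ts

isoT : Tree → Tree → Bool
isoT s t = eqT (canon s) (canon t)

-- Grafting a new terminal vertex at each vertex of a tree:
-- graft t lists, one entry per vertex v of t, the tree obtained from t by
-- attaching a new edge at v to a new terminal vertex.

mutual
  graft : Tree → List Tree
  graft (node ts) = node (• ∷ ts) ∷ map node (graftL ts)

  graftL : List Tree → List (List Tree)
  graftL [] = []
  graftL (t ∷ ts) = map (_∷ ts) (graft t) ++ map (t ∷_) (graftL ts)

-- Pruning: prune t lists, one entry per edge of t whose endpoint is a
-- terminal (non-root) vertex, the tree obtained by deleting that edge and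
-- its terminal endpoint.

mutual
  prune : Tree → List Tree
  prune (node ts) = map node (pruneL ts)

  pruneL : List Tree → List (List Tree)
  pruneL [] = []
  pruneL (node [] ∷ ts) = ts ∷ map (node [] ∷_) (pruneL ts)
  pruneL (node (c ∷ cs) ∷ ts) =
    map (_∷ ts) (prune (node (c ∷ cs))) ++ map (node (c ∷ cs) ∷_) (pruneL ts)

module _ {c ℓ : Level} (K : CommutativeRing c ℓ) where
  open CommutativeRing K

  IsField : Set (c ⊔ ℓ)
  IsField = (¬ (1# ≈ 0#)) × (∀ x → ¬ (x ≈ 0#) → ∃ λ y → (x * y) ≈ 1#)

  natToK : ℕ → Carrier
  natToK zero = 0#
  natToK (suc n) = 1# + natToK n

  CharZero : Set ℓ
  CharZero = ∀ n → natToK (suc n) ≈ 0# → ⊥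

-- Linear combinations.  k{T} : finite formal k-linear combinations of
-- rooted trees; H_K : finite formal k-linear combinations of forests.

module LinComb {c ℓ : Level} (K : CommutativeRing c ℓ) where
  open CommutativeRing K

  kT : Set c
  kT = List (Carrier × Tree)

  HK : Set c
  HK = List (Carrier × Forest)

  coeff : kT → Tree → Carrier
  coeff [] s = 0#
  coeff ((a , t) ∷ x) s = (if isoT t s then a else 0#) + coeff x s

  infix 4 _≈T_
  _≈T_ : kT → kT → Set ℓ
  x ≈T y = ∀ s → coeff x s ≈ coeff y s

  _-T_ : kT → kT → kT
  x -T y = x ++ map (λ { (a , t) → (- a , t) }) y

  tr : Tree → kT
  tr t = (1# , t) ∷ []

  linT : (Tree → kT) → kT → kT
  linT f [] = []
  linT f ((a , t) ∷ x) = map (λ { (b , s) → (a * b , s) }) (f t) ++ linT f x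

  -- 𝔑(t) = Σ_{t ⊲ t'} n(t;t') t'  (sum over vertices of t of the grafts)
  𝔑₀ : Tree → kT
  𝔑₀ t = map (λ t' → (1# , t')) (graft t)

  -- 𝔓(t) = Σ_{t' ⊲ t} m(t';t) t'  (sum over terminal edges of t); 𝔓(•) = 0
  𝔓₀ : Tree → kT
  𝔓₀ t = map (λ t' → (1# , t')) (prune t)

  𝔑 : kT → kT
  𝔑 = linT 𝔑₀

  𝔓 : kT → kT
  𝔓 = linT 𝔓₀

  B₊ : HK → kT
  B₊ = map (λ { (a , f) → (a , node f) })

  mon : Forest → HK
  mon u = (1# , u) ∷ []

  -- N and P on rooted trees, with values in H_K
  -- (N(t) = 𝔑(t), P(t) = 𝔓(t) for |t| ≥ 2, P(•) = 1)
  Ntree : Tree → HK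
  Ntree t = map (λ t' → (1# , t' ∷ [])) (graft t)

  Ptree : Tree → HK
  Ptree (node []) = (1# , []) ∷ []
  Ptree (node (c ∷ cs)) = map (λ t' → (1# , t' ∷ [])) (prune (node (c ∷ cs)))

  derivMon : (Tree → HK) → Forest → HK
  derivMon D [] = []
  derivMon D (t ∷ u) =
    map (λ { (a , f) → (a , f ++ u) }) (D t)
    ++ map (λ { (a , f) → (a , t ∷ f) }) (derivMon D u)

  N : Forest → HK
  N = derivMon Ntree

  P : Forest → HK
  P = derivMon Ptree

{-# OPTIONS --safe #-}
module Submission where

open import Defs
open import Data.Bool using (true; false; if_then_else_)
open import Data.Product using (_×_; _,_)
open import Data.List using (List; []; _∷_; _++_; map; [_])
open import Data.List.Properties using (map-++; map-∘)
open import Algebra.Bundles using (CommutativeRing)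
open import Function using (_∘_)
import Algebra.Properties.Ring as RingProperties
open import Relation.Binary.PropositionalEquality as ≡ using (_≡_; cong; cong₂)

-- The vertices of B₊(t₁ ⋯ tₙ) are its new root together with the vertices
-- of the tᵢ, and its terminal edges are the terminal edges of the tᵢ together
-- with the edges from the root to those tᵢ that equal •.  Grafting at the
-- root gives B₊(• t₁ ⋯ tₙ); grafting inside tᵢ, or pruning a terminal edge
-- of tᵢ, replaces tᵢ by a term of N(tᵢ) resp. P(tᵢ), and removing the root
-- edge to tᵢ = • replaces tᵢ by P(•) = 1.  This is the Leibniz rule.

leibniz : (Tree → List Forest) → Forest → List Forest
leibniz F []      = []
leibniz F (t ∷ u) = map (_++ u) (F t) ++ map (t ∷_) (leibniz F u)

graftTerms : Tree → List Forest
graftTerms t = map [_] (graft t)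

pruneTerms : Tree → List Forest
pruneTerms (node [])        = [ [] ]
pruneTerms t@(node (_ ∷ _)) = map [_] (prune t)

graftL≡leibniz-graftTerms : ∀ u → graftL u ≡ leibniz graftTerms u
graftL≡leibniz-graftTerms []      = ≡.refl
graftL≡leibniz-graftTerms (t ∷ u) =
  cong₂ _++_ (map-∘ (graft t)) (cong (map (t ∷_)) (graftL≡leibniz-graftTerms u))

pruneL≡leibniz-pruneTerms : ∀ u → pruneL u ≡ leibniz pruneTerms u
pruneL≡leibniz-pruneTerms []            = ≡.refl
pruneL≡leibniz-pruneTerms (node [] ∷ u) =
  cong (u ∷_) (cong (map (• ∷_)) (pruneL≡leibniz-pruneTerms u))
pruneL≡leibniz-pruneTerms (t@(node (_ ∷ _)) ∷ u) =
  cong₂ _++_ (map-∘ (prune t)) (cong (map (t ∷_)) (pruneL≡leibniz-pruneTerms u))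

module _ {c ℓ} (K : CommutativeRing c ℓ) where
  open CommutativeRing K
  open LinComb K
  open RingProperties ring using (-0#≈0#; -‿+-comm; xyx⁻¹≈y)

  unitCoeffs : {A : Set} → List A → List (Carrier × A)
  unitCoeffs = map (1# ,_)

  map-unitCoeffs : {A B : Set} {h : Carrier × A → Carrier × B} {g : A → B} →
                   (∀ x → h (1# , x) ≡ (1# , g x)) →
                   ∀ xs → map h (unitCoeffs xs) ≡ unitCoeffs (map g xs)
  map-unitCoeffs h≡g []       = ≡.refl
  map-unitCoeffs h≡g (x ∷ xs) = cong₂ _∷_ (h≡g x) (map-unitCoeffs h≡g xs)

  derivMon-unitCoeffs : ∀ {D F} → (∀ t → D t ≡ unitCoeffs (F t)) →
                        ∀ u → derivMon D u ≡ unitCoeffs (leibniz F u)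
  derivMon-unitCoeffs D≡F []      = ≡.refl
  derivMon-unitCoeffs {D} {F} D≡F (t ∷ u) = begin
    derivMon D (t ∷ u)
      ≡⟨ cong₂ (λ x y → map _ x ++ map _ y) (D≡F t) (derivMon-unitCoeffs D≡F u) ⟩
    map _ (unitCoeffs (F t)) ++ map _ (unitCoeffs (leibniz F u))
      ≡⟨ cong₂ _++_ (map-unitCoeffs (λ _ → ≡.refl) (F t))
                    (map-unitCoeffs (λ _ → ≡.refl) (leibniz F u)) ⟩
    unitCoeffs (map (_++ u) (F t)) ++ unitCoeffs (map (t ∷_) (leibniz F u))
      ≡⟨ map-++ _ (map (_++ u) (F t)) _ ⟨
    unitCoeffs (leibniz F (t ∷ u)) ∎
    where open ≡.≡-Reasoning

  Ntree≡unitCoeffs-graftTerms : ∀ t → Ntree t ≡ unitCoeffs (graftTerms t)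
  Ntree≡unitCoeffs-graftTerms t = map-∘ (graft t)

  Ptree≡unitCoeffs-pruneTerms : ∀ t → Ptree t ≡ unitCoeffs (pruneTerms t)
  Ptree≡unitCoeffs-pruneTerms (node [])      = ≡.refl
  Ptree≡unitCoeffs-pruneTerms (node (_ ∷ _)) = map-∘ _

  B₊-unitCoeffs : ∀ us → B₊ (unitCoeffs us) ≡ unitCoeffs (map node us)
  B₊-unitCoeffs us = map-unitCoeffs (λ _ → ≡.refl) us

  B₊-P : ∀ u → B₊ (P u) ≡ 𝔓₀ (node u)
  B₊-P u = begin
    B₊ (P u)
      ≡⟨ cong B₊ (derivMon-unitCoeffs Ptree≡unitCoeffs-pruneTerms u) ⟩
    B₊ (unitCoeffs (leibniz pruneTerms u))
      ≡⟨ cong (B₊ ∘ unitCoeffs) (pruneL≡leibniz-pruneTerms u) ⟨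
    B₊ (unitCoeffs (pruneL u))
      ≡⟨ B₊-unitCoeffs (pruneL u) ⟩
    𝔓₀ (node u) ∎
    where open ≡.≡-Reasoning

  𝔑₀-node : ∀ u → 𝔑₀ (node u) ≡ tr (node (• ∷ u)) ++ B₊ (N u)
  𝔑₀-node u = cong (_ ∷_) (begin
    unitCoeffs (map node (graftL u))
      ≡⟨ B₊-unitCoeffs (graftL u) ⟨
    B₊ (unitCoeffs (graftL u))
      ≡⟨ cong (B₊ ∘ unitCoeffs) (graftL≡leibniz-graftTerms u) ⟩
    B₊ (unitCoeffs (leibniz graftTerms u))
      ≡⟨ cong B₊ (derivMon-unitCoeffs Ntree≡unitCoeffs-graftTerms u) ⟨
    B₊ (N u) ∎)
    where open ≡.≡-Reasoning

  open import Relation.Binary.Reasoning.Setoid setoid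

  coeff-++ : ∀ x y s → coeff (x ++ y) s ≈ coeff x s + coeff y s
  coeff-++ []            y s = sym (+-identityˡ _)
  coeff-++ ((a , t) ∷ x) y s = trans (+-congˡ (coeff-++ x y s)) (sym (+-assoc _ _ _))

  if-negate : ∀ b a → (if b then - a else 0#) ≈ - (if b then a else 0#)
  if-negate true  a = refl
  if-negate false a = sym -0#≈0#

  coeff-negate : ∀ y s → coeff ([] -T y) s ≈ - coeff y s
  coeff-negate []            s = sym -0#≈0#
  coeff-negate ((a , t) ∷ y) s = begin
    (if isoT t s then - a else 0#) + coeff ([] -T y) s
      ≈⟨ +-cong (if-negate (isoT t s) a) (coeff-negate y s) ⟩
    - (if isoT t s then a else 0#) + - coeff y s
      ≈⟨ -‿+-comm _ _ ⟩
    - coeff ((a , t) ∷ y) s ∎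

  coeff--T : ∀ x y s → coeff (x -T y) s ≈ coeff x s - coeff y s
  coeff--T x y s = trans (coeff-++ x ([] -T y) s) (+-congˡ (coeff-negate y s))

  if-scale : ∀ b a r → (if b then a * r else 0#) ≈ a * (if b then r else 0#)
  if-scale true  a r = refl
  if-scale false a r = sym (zeroʳ a)

  coeff-linT-single : ∀ a t y s → coeff (linT (λ _ → y) ((a , t) ∷ [])) s ≈ a * coeff y s
  coeff-linT-single a t []            s = sym (zeroʳ a)
  coeff-linT-single a t ((b , r) ∷ y) s = begin
    (if isoT r s then a * b else 0#) + coeff (linT (λ _ → y) ((a , t) ∷ [])) s
      ≈⟨ +-cong (if-scale (isoT r s) a b) (coeff-linT-single a t y s) ⟩
    a * (if isoT r s then b else 0#) + a * coeff y s
      ≈⟨ distribˡ a _ _ ⟨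
    a * coeff ((b , r) ∷ y) s ∎

  coeff-linT-tr : ∀ f t s → coeff (linT f (tr t)) s ≈ coeff (f t) s
  coeff-linT-tr f t s = trans (coeff-linT-single 1# t (f t) s) (*-identityˡ _)

  B₊∘P≈𝔓∘B₊ : ∀ u → B₊ (P u) ≈T 𝔓 (B₊ (mon u))
  B₊∘P≈𝔓∘B₊ u s = begin
    coeff (B₊ (P u)) s            ≡⟨ cong (λ x → coeff x s) (B₊-P u) ⟩
    coeff (𝔓₀ (node u)) s         ≈⟨ coeff-linT-tr 𝔓₀ (node u) s ⟨
    coeff (𝔓 (B₊ (mon u))) s      ∎

  B₊∘N≈𝔑∘B₊-B₊• : ∀ u → B₊ (N u) ≈T 𝔑 (B₊ (mon u)) -T B₊ (mon (• ∷ u))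
  B₊∘N≈𝔑∘B₊-B₊• u s = sym (begin
    coeff (𝔑 (B₊ (mon u)) -T B₊ (mon (• ∷ u))) s
      ≈⟨ coeff--T (𝔑 (B₊ (mon u))) _ s ⟩
    coeff (𝔑 (tr (node u))) s - δ
      ≈⟨ +-congʳ (coeff-linT-tr 𝔑₀ (node u) s) ⟩
    coeff (𝔑₀ (node u)) s - δ
      ≡⟨ cong (λ x → coeff x s - δ) (𝔑₀-node u) ⟩
    coeff (tr (node (• ∷ u)) ++ B₊ (N u)) s - δ
      ≈⟨ +-congʳ (coeff-++ (tr (node (• ∷ u))) (B₊ (N u)) s) ⟩
    δ + coeff (B₊ (N u)) s - δ
      ≈⟨ xyx⁻¹≈y δ _ ⟩
    coeff (B₊ (N u)) s ∎)
    where
    δ : Carrier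
    δ = coeff (tr (node (• ∷ u))) s

-- The identities hold over any commutative ring.
proposition3p2 : ∀ {c ℓ} (K : CommutativeRing c ℓ) → IsField K → CharZero K →
    (u : Forest) →
      (LinComb._≈T_ K (LinComb.B₊ K (LinComb.P K u)) (LinComb.𝔓 K (LinComb.B₊ K (LinComb.mon K u))))
      × (LinComb._≈T_ K (LinComb.B₊ K (LinComb.N K u))
           (LinComb._-T_ K (LinComb.𝔑 K (LinComb.B₊ K (LinComb.mon K u))) (LinComb.B₊ K (LinComb.mon K (• ∷ u)))))
proposition3p2 K _ _ u = B₊∘P≈𝔓∘B₊ K u , B₊∘N≈𝔑∘B₊-B₊• K u
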